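{- Let $k\ge3$. In $\mathbb{Z}[x,y]$ let $D_1(k)=y^2+2y+1$, $D_2(k)=[(k-2)(k-1)-1]y+x+(k-2)(k-1)$, $D_3(k)=k(k-2)(y+1)$. Then $D_1(k),D_2(k),D_3(k)$ belong to the ideal generated by $H_1(k)=\sum_{j=0}^{2k-2}y^j+x$, $H_2(k)=y^{2k-2}+x\sum_{j=0}^{2k-2}y^j$, $H_3(k)=y+\sum_{i=0}^{2k-2}x^i$, $H_4(k)=y\sum_{i=0}^{2k-2}x^i+x^{2k-2}$, $H_5(k)=xy+x+y+1$ (the polynomials of the tiles of $\mathcal{T}_{2k}^+$). -}

module Defs where

open import Data.Nat using (ℕ; zero; suc; _∸_)
import Data.Nat
open import Data.Integer using (ℤ; +_; _+_; _*_; _-_; 0ℤ; 1ℤ)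
open import Data.List using (List; []; _∷_; map)
open import Data.Vec using (Vec; []; _∷_)
open import Data.Product using (Σ)
open import Relation.Binary.PropositionalEquality using (_≡_)

-- Dense polynomials over a coefficient type, as coefficient lists
-- (entry i = coefficient of t^i).  Trailing zeros are allowed; equality
-- of polynomials is coefficient-wise (see _≈P_ below).

addL : {A : Set} → (A → A → A) → List A → List A → List A
addL f []       q        = q
addL f (a ∷ p)  []       = a ∷ p
addL f (a ∷ p)  (b ∷ q)  = f a b ∷ addL f p q

mulL : {A : Set} → A → (A → A → A) → (A → A → A) → List A → List A → List A
mulL z ad mu []      q = []
mulL z ad mu (a ∷ p) q = addL ad (map (mu a) q) (z ∷ mulL z ad mu p q)

Poly₁ : Set
Poly₁ = List ℤ

_+₁_ : Poly₁ → Poly₁ → Poly₁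
_+₁_ = addL _+_

_*₁_ : Poly₁ → Poly₁ → Poly₁
_*₁_ = mulL 0ℤ _+_ _*_

-- ℤ[x,y] = (ℤ[y])[x] : entry i is the coefficient (a polynomial in y) of x^i
Poly : Set
Poly = List Poly₁

_+P_ : Poly → Poly → Poly
_+P_ = addL _+₁_

_*P_ : Poly → Poly → Poly
_*P_ = mulL [] _+₁_ _*₁_

infixl 6 _+P_
infixl 7 _*P_

coeff₁ : Poly₁ → ℕ → ℤ
coeff₁ []      j       = 0ℤ
coeff₁ (a ∷ p) zero    = a
coeff₁ (a ∷ p) (suc j) = coeff₁ p j

coeff : Poly → ℕ → ℕ → ℤ
coeff []      i       j = 0ℤ
coeff (a ∷ p) zero    j = coeff₁ a j
coeff (a ∷ p) (suc i) j = coeff p i j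

_≈P_ : Poly → Poly → Set
p ≈P q = ∀ i j → coeff p i j ≡ coeff q i j

cst : ℤ → Poly
cst c = (c ∷ []) ∷ []

0P 1P X Y : Poly
0P = []
1P = cst 1ℤ
X  = [] ∷ ((1ℤ ∷ []) ∷ [])
Y  = (0ℤ ∷ 1ℤ ∷ []) ∷ []

_^P_ : Poly → ℕ → Poly
p ^P zero  = 1P
p ^P suc n = p *P (p ^P n)

sumTo : ℕ → (ℕ → Poly) → Poly
sumTo zero    f = f zero
sumTo (suc n) f = sumTo n f +P f (suc n)

linComb : {n : ℕ} → Vec Poly n → Vec Poly n → Poly
linComb []       []       = 0P
linComb (c ∷ cs) (g ∷ gs) = c *P g +P linComb cs gs

_∈Ideal_ : {n : ℕ} → Poly → Vec Poly n → Set
_∈Ideal_ {n} p gs = Σ (Vec Poly n) (λ cs → p ≈P linComb cs gs)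

kℤ : ℕ → ℤ
kℤ k = + k

D₁ : ℕ → Poly
D₁ k = Y ^P 2 +P cst (+ 2) *P Y +P 1P

D₂ : ℕ → Poly
D₂ k = cst ((kℤ k - + 2) * (kℤ k - + 1) - 1ℤ) *P Y +P X
       +P cst ((kℤ k - + 2) * (kℤ k - + 1))

D₃ : ℕ → Poly
D₃ k = cst (kℤ k * (kℤ k - + 2)) *P (Y +P 1P)

H₁ H₂ H₃ H₄ H₅ : ℕ → Poly
H₁ k = sumTo (2 Data.Nat.* k ∸ 2) (λ j → Y ^P j) +P X
H₂ k = Y ^P (2 Data.Nat.* k ∸ 2) +P X *P sumTo (2 Data.Nat.* k ∸ 2) (λ j → Y ^P j)
H₃ k = Y +P sumTo (2 Data.Nat.* k ∸ 2) (λ i → X ^P i)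
H₄ k = Y *P sumTo (2 Data.Nat.* k ∸ 2) (λ i → X ^P i) +P X ^P (2 Data.Nat.* k ∸ 2)
H₅ k = X *P Y +P X +P Y +P 1P

tiles : ℕ → Vec Poly 5
tiles k = H₁ k ∷ H₂ k ∷ H₃ k ∷ H₄ k ∷ H₅ k ∷ []

-- Work in ℤ[x,y] modulo I = (H₁,…,H₅) and put u = y + 1, v = x + 1, so that H₅ = uv.
-- As x u ≡ −u, the sum of the 2m + 1 powers of x acts on u as the identity, so
-- H₃ u ≡ (y + 1) u = u² and D₁ = u² ∈ I.  Then y^i ≡ (−1)^i (1 − i u), hence
-- Σ_{i≤2m} y^i ≡ 1 − m u and H₁ gives v ≡ m u; symmetrically u ≡ m v, so (m² − 1) u ∈ I.
-- With m = k − 1 this is D₃ = k(k − 2) u, and D₂ = (m(m − 1) − 1) u + v ≡ (m² − 1) u.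

module Submission where

open import Defs
open import Algebra
open import Level using (0ℓ; _⊔_)
open import Data.Nat as ℕ using (ℕ; zero; suc; _≤_; s≤s; z≤n; _∸_)
import Data.Nat.Properties as ℕₚ
open import Data.Nat.Tactic.RingSolver using (solve-∀)
open import Data.Integer using (+_)
import Data.Integer.Properties as ℤ
open import Data.List as List using (List; []; _∷_)
open import Data.Vec as Vec using (Vec; []; _∷_; lookup; replicate; zipWith)
open import Data.Fin using (zero; suc)
open import Data.Product using (Σ; _,_)
open import Relation.Binary.PropositionalEquality as ≡ using (_≡_; cong; cong₂; subst; module ≡-Reasoning)
import Relation.Binary.Reasoning.Setoid

module Polynomials {ℓ} (R : CommutativeRing 0ℓ ℓ) where

  open CommutativeRing R
  open import Algebra.Properties.Ring ring using (-0#≈0#)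
  private module ≈-Reasoning = Relation.Binary.Reasoning.Setoid setoid

  Polynomial : Set
  Polynomial = List Carrier

  coefficient : Polynomial → ℕ → Carrier
  coefficient []      i       = 0#
  coefficient (a ∷ p) zero    = a
  coefficient (a ∷ p) (suc i) = coefficient p i

  -- Lists are compared up to trailing zeros.
  infix 4 _≋_
  record _≋_ (p q : Polynomial) : Set ℓ where
    constructor coefficientwise
    field coefficient-≈ : ∀ i → coefficient p i ≈ coefficient q i
  open _≋_ public

  infixl 6 _⊕_
  infixl 7 _⊗_ _·_

  _⊕_ _⊗_ : Polynomial → Polynomial → Polynomial
  _⊕_ = addL _+_
  _⊗_ = mulL 0# _+_ _*_

  _·_ : Carrier → Polynomial → Polynomial
  a · p = List.map (a *_) p

  ⊝_ : Polynomial → Polynomial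
  ⊝_ = List.map (-_)

  𝟙 : Polynomial
  𝟙 = 1# ∷ []

  ≋-refl : ∀ {p} → p ≋ p
  ≋-refl = coefficientwise λ _ → refl

  ≋-sym : ∀ {p q} → p ≋ q → q ≋ p
  ≋-sym e = coefficientwise λ i → sym (coefficient-≈ e i)

  ≋-trans : ∀ {p q r} → p ≋ q → q ≋ r → p ≋ r
  ≋-trans e f = coefficientwise λ i → trans (coefficient-≈ e i) (coefficient-≈ f i)

  ∷-cong : ∀ {a b p q} → a ≈ b → p ≋ q → a ∷ p ≋ b ∷ q
  ∷-cong a≈b e = coefficientwise λ { zero → a≈b ; (suc i) → coefficient-≈ e i }

  0∷[]≋[] : 0# ∷ [] ≋ []
  0∷[]≋[] = coefficientwise λ { zero → refl ; (suc i) → refl }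

  coefficient-⊕ : ∀ p q i → coefficient (p ⊕ q) i ≈ coefficient p i + coefficient q i
  coefficient-⊕ []      q       i       = sym (+-identityˡ _)
  coefficient-⊕ (a ∷ p) []      i       = sym (+-identityʳ _)
  coefficient-⊕ (a ∷ p) (b ∷ q) zero    = refl
  coefficient-⊕ (a ∷ p) (b ∷ q) (suc i) = coefficient-⊕ p q i

  coefficient-· : ∀ a p i → coefficient (a · p) i ≈ a * coefficient p i
  coefficient-· a []      i       = sym (zeroʳ a)
  coefficient-· a (b ∷ p) zero    = refl
  coefficient-· a (b ∷ p) (suc i) = coefficient-· a p i

  coefficient-⊝ : ∀ p i → coefficient (⊝ p) i ≈ - coefficient p i
  coefficient-⊝ []      i       = sym (-0#≈0#)
  coefficient-⊝ (a ∷ p) zero    = refl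
  coefficient-⊝ (a ∷ p) (suc i) = coefficient-⊝ p i

  ⊕-cong : ∀ {p p′ q q′} → p ≋ p′ → q ≋ q′ → p ⊕ q ≋ p′ ⊕ q′
  ⊕-cong {p} {p′} {q} {q′} e f = coefficientwise λ i → begin
    coefficient (p ⊕ q) i                  ≈⟨ coefficient-⊕ p q i ⟩
    coefficient p i + coefficient q i      ≈⟨ +-cong (coefficient-≈ e i) (coefficient-≈ f i) ⟩
    coefficient p′ i + coefficient q′ i    ≈⟨ coefficient-⊕ p′ q′ i ⟨
    coefficient (p′ ⊕ q′) i                ∎
    where open ≈-Reasoning

  ⊕-assoc : ∀ p q r → p ⊕ q ⊕ r ≋ p ⊕ (q ⊕ r)
  ⊕-assoc p q r = coefficientwise λ i → begin
    coefficient (p ⊕ q ⊕ r) i                               ≈⟨ coefficient-⊕ (p ⊕ q) r i ⟩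
    coefficient (p ⊕ q) i + coefficient r i                 ≈⟨ +-congʳ (coefficient-⊕ p q i) ⟩
    coefficient p i + coefficient q i + coefficient r i     ≈⟨ +-assoc _ _ _ ⟩
    coefficient p i + (coefficient q i + coefficient r i)   ≈⟨ +-congˡ (coefficient-⊕ q r i) ⟨
    coefficient p i + coefficient (q ⊕ r) i                 ≈⟨ coefficient-⊕ p (q ⊕ r) i ⟨
    coefficient (p ⊕ (q ⊕ r)) i                             ∎
    where open ≈-Reasoning

  ⊕-comm : ∀ p q → p ⊕ q ≋ q ⊕ p
  ⊕-comm p q = coefficientwise λ i →
    trans (coefficient-⊕ p q i) (trans (+-comm _ _) (sym (coefficient-⊕ q p i)))

  ⊕-identityʳ : ∀ p → p ⊕ [] ≋ p
  ⊕-identityʳ p = coefficientwise λ i → trans (coefficient-⊕ p [] i) (+-identityʳ _)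

  ⊝-cong : ∀ {p q} → p ≋ q → ⊝ p ≋ ⊝ q
  ⊝-cong {p} {q} e = coefficientwise λ i →
    trans (coefficient-⊝ p i) (trans (-‿cong (coefficient-≈ e i)) (sym (coefficient-⊝ q i)))

  ⊝-inverseˡ : ∀ p → ⊝ p ⊕ p ≋ []
  ⊝-inverseˡ p = coefficientwise λ i →
    trans (coefficient-⊕ (⊝ p) p i) (trans (+-congʳ (coefficient-⊝ p i)) (-‿inverseˡ _))

  ⊝-inverseʳ : ∀ p → p ⊕ ⊝ p ≋ []
  ⊝-inverseʳ p = ≋-trans (⊕-comm p (⊝ p)) (⊝-inverseˡ p)

  ⊕-isAbelianGroup : IsAbelianGroup _≋_ _⊕_ [] ⊝_
  ⊕-isAbelianGroup = record
    { isGroup = record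
      { isMonoid = record
        { isSemigroup = record
          { isMagma = record
            { isEquivalence = record { refl = ≋-refl ; sym = ≋-sym ; trans = ≋-trans }
            ; ∙-cong = ⊕-cong }
          ; assoc = ⊕-assoc }
        ; identity = (λ _ → ≋-refl) , ⊕-identityʳ }
      ; inverse = ⊝-inverseˡ , ⊝-inverseʳ
      ; ⁻¹-cong = ⊝-cong }
    ; comm = ⊕-comm }

  ⊕-abelianGroup : AbelianGroup 0ℓ ℓ
  ⊕-abelianGroup = record { isAbelianGroup = ⊕-isAbelianGroup }

  private module ≋-Reasoning = Relation.Binary.Reasoning.Setoid (AbelianGroup.setoid ⊕-abelianGroup)

  open import Algebra.Properties.CommutativeSemigroup (AbelianGroup.commutativeSemigroup ⊕-abelianGroup)
    using (interchange; x∙yz≈y∙xz)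

  ·-congʳ : ∀ a {p q} → p ≋ q → a · p ≋ a · q
  ·-congʳ a {p} {q} e = coefficientwise λ i →
    trans (coefficient-· a p i) (trans (*-congˡ (coefficient-≈ e i)) (sym (coefficient-· a q i)))

  ·-distrib-⊕ : ∀ a p q → a · (p ⊕ q) ≋ a · p ⊕ a · q
  ·-distrib-⊕ a p q = coefficientwise λ i → begin
    coefficient (a · (p ⊕ q)) i                                ≈⟨ coefficient-· a (p ⊕ q) i ⟩
    a * coefficient (p ⊕ q) i                                  ≈⟨ *-congˡ (coefficient-⊕ p q i) ⟩
    a * (coefficient p i + coefficient q i)                    ≈⟨ distribˡ a _ _ ⟩
    a * coefficient p i + a * coefficient q i                  ≈⟨ +-cong (coefficient-· a p i) (coefficient-· a q i) ⟨
    coefficient (a · p) i + coefficient (a · q) i              ≈⟨ coefficient-⊕ (a · p) (a · q) i ⟨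
    coefficient (a · p ⊕ a · q) i                              ∎
    where open ≈-Reasoning

  ·-assoc : ∀ a b p → (a * b) · p ≋ a · (b · p)
  ·-assoc a b p = coefficientwise λ i → begin
    coefficient ((a * b) · p) i   ≈⟨ coefficient-· (a * b) p i ⟩
    a * b * coefficient p i       ≈⟨ *-assoc a b _ ⟩
    a * (b * coefficient p i)     ≈⟨ *-congˡ (coefficient-· b p i) ⟨
    a * coefficient (b · p) i     ≈⟨ coefficient-· a (b · p) i ⟨
    coefficient (a · (b · p)) i   ∎
    where open ≈-Reasoning

  0·-zero : ∀ p → 0# · p ≋ []
  0·-zero p = coefficientwise λ i → trans (coefficient-· 0# p i) (zeroˡ _)

  1·-identity : ∀ p → 1# · p ≋ p
  1·-identity p = coefficientwise λ i → trans (coefficient-· 1# p i) (*-identityˡ _)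

  ⊗-congʳ : ∀ p {q q′} → q ≋ q′ → p ⊗ q ≋ p ⊗ q′
  ⊗-congʳ []      e = ≋-refl
  ⊗-congʳ (a ∷ p) e = ⊕-cong (·-congʳ a e) (∷-cong refl (⊗-congʳ p e))

  ⊗-zeroʳ : ∀ p → p ⊗ [] ≋ []
  ⊗-zeroʳ []      = ≋-refl
  ⊗-zeroʳ (a ∷ p) = ≋-trans (∷-cong refl (⊗-zeroʳ p)) 0∷[]≋[]

  ⊗-consʳ : ∀ p b q → p ⊗ (b ∷ q) ≋ b · p ⊕ (0# ∷ p ⊗ q)
  ⊗-consʳ []      b q = ≋-sym 0∷[]≋[]
  ⊗-consʳ (a ∷ p) b q = ∷-cong (+-congʳ (*-comm a b)) (begin
    a · q ⊕ p ⊗ (b ∷ q)                 ≈⟨ ⊕-cong ≋-refl (⊗-consʳ p b q) ⟩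
    a · q ⊕ (b · p ⊕ (0# ∷ p ⊗ q))      ≈⟨ x∙yz≈y∙xz (a · q) (b · p) _ ⟩
    b · p ⊕ (a · q ⊕ (0# ∷ p ⊗ q))      ∎)
    where open ≋-Reasoning

  ⊗-comm : ∀ p q → p ⊗ q ≋ q ⊗ p
  ⊗-comm []      q = ≋-sym (⊗-zeroʳ q)
  ⊗-comm (a ∷ p) q = ≋-trans (⊕-cong ≋-refl (∷-cong refl (⊗-comm p q))) (≋-sym (⊗-consʳ q a p))

  ⊗-distribˡ : ∀ p q r → p ⊗ (q ⊕ r) ≋ p ⊗ q ⊕ p ⊗ r
  ⊗-distribˡ []      q r = ≋-refl
  ⊗-distribˡ (a ∷ p) q r = begin
    a · (q ⊕ r) ⊕ (0# ∷ p ⊗ (q ⊕ r))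
      ≈⟨ ⊕-cong (·-distrib-⊕ a q r) (∷-cong (sym (+-identityʳ 0#)) (⊗-distribˡ p q r)) ⟩
    (a · q ⊕ a · r) ⊕ ((0# ∷ p ⊗ q) ⊕ (0# ∷ p ⊗ r))
      ≈⟨ interchange (a · q) (a · r) _ _ ⟩
    (a · q ⊕ (0# ∷ p ⊗ q)) ⊕ (a · r ⊕ (0# ∷ p ⊗ r))    ∎
    where open ≋-Reasoning

  ⊗-distribʳ : ∀ r p q → (p ⊕ q) ⊗ r ≋ p ⊗ r ⊕ q ⊗ r
  ⊗-distribʳ r p q = begin
    (p ⊕ q) ⊗ r        ≈⟨ ⊗-comm (p ⊕ q) r ⟩
    r ⊗ (p ⊕ q)        ≈⟨ ⊗-distribˡ r p q ⟩
    r ⊗ p ⊕ r ⊗ q      ≈⟨ ⊕-cong (⊗-comm r p) (⊗-comm r q) ⟩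
    p ⊗ r ⊕ q ⊗ r      ∎
    where open ≋-Reasoning

  ·-⊗ : ∀ a p q → (a · p) ⊗ q ≋ a · (p ⊗ q)
  ·-⊗ a []      q = ≋-refl
  ·-⊗ a (b ∷ p) q = begin
    (a * b) · q ⊕ (0# ∷ (a · p) ⊗ q)    ≈⟨ ⊕-cong (·-assoc a b q) (∷-cong (sym (zeroʳ a)) (·-⊗ a p q)) ⟩
    a · (b · q) ⊕ a · (0# ∷ p ⊗ q)      ≈⟨ ·-distrib-⊕ a (b · q) _ ⟨
    a · (b · q ⊕ (0# ∷ p ⊗ q))          ∎
    where open ≋-Reasoning

  0∷-⊗ : ∀ p q → (0# ∷ p) ⊗ q ≋ 0# ∷ p ⊗ q
  0∷-⊗ p q = ⊕-cong (0·-zero q) ≋-refl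

  ⊗-assoc : ∀ p q r → p ⊗ q ⊗ r ≋ p ⊗ (q ⊗ r)
  ⊗-assoc []      q r = ≋-refl
  ⊗-assoc (a ∷ p) q r = begin
    (a · q ⊕ (0# ∷ p ⊗ q)) ⊗ r              ≈⟨ ⊗-distribʳ r (a · q) _ ⟩
    (a · q) ⊗ r ⊕ (0# ∷ p ⊗ q) ⊗ r          ≈⟨ ⊕-cong (·-⊗ a q r) (0∷-⊗ (p ⊗ q) r) ⟩
    a · (q ⊗ r) ⊕ (0# ∷ p ⊗ q ⊗ r)          ≈⟨ ⊕-cong ≋-refl (∷-cong refl (⊗-assoc p q r)) ⟩
    a · (q ⊗ r) ⊕ (0# ∷ p ⊗ (q ⊗ r))        ∎
    where open ≋-Reasoning

  ⊗-identityˡ : ∀ p → 𝟙 ⊗ p ≋ p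
  ⊗-identityˡ p = ≋-trans (⊕-cong (1·-identity p) 0∷[]≋[]) (⊕-identityʳ p)

  ⊗-cong : ∀ {p p′ q q′} → p ≋ p′ → q ≋ q′ → p ⊗ q ≋ p′ ⊗ q′
  ⊗-cong {p} {p′} {q} {q′} e f = begin
    p ⊗ q      ≈⟨ ⊗-comm p q ⟩
    q ⊗ p      ≈⟨ ⊗-congʳ q e ⟩
    q ⊗ p′     ≈⟨ ⊗-comm q p′ ⟩
    p′ ⊗ q     ≈⟨ ⊗-congʳ p′ f ⟩
    p′ ⊗ q′    ∎
    where open ≋-Reasoning

  polynomialRing : CommutativeRing 0ℓ ℓ
  polynomialRing = record
    { isCommutativeRing = record
      { isRing = record
        { +-isAbelianGroup = ⊕-isAbelianGroup
        ; *-cong = ⊗-cong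
        ; *-assoc = ⊗-assoc
        ; *-identity = ⊗-identityˡ , λ p → ≋-trans (⊗-comm p 𝟙) (⊗-identityˡ p)
        ; distrib = ⊗-distribˡ , ⊗-distribʳ }
      ; *-comm = ⊗-comm } }

module Ideal {c ℓ} (R : CommutativeRing c ℓ) where

  open CommutativeRing R
  open import Algebra.Properties.Ring ring using (-1*x≈-x; -‿+-comm)
  open import Data.Product using (_×_)
  open import Algebra.Solver.Ring.NaturalCoefficients.Default commutativeSemiring
  private module ≈-Reasoning = Relation.Binary.Reasoning.Setoid setoid

  linearCombination : ∀ {n} → Vec Carrier n → Vec Carrier n → Carrier
  linearCombination []       []       = 0#
  linearCombination (c ∷ cs) (g ∷ gs) = c * g + linearCombination cs gs

  infix 4 _∈⟨_⟩
  _∈⟨_⟩ : ∀ {n} → Carrier → Vec Carrier n → Set (c ⊔ ℓ)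
  t ∈⟨ gs ⟩ = Σ _ λ cs → t ≈ linearCombination cs gs

  linearCombination-0 : ∀ {n} (gs : Vec Carrier n) → linearCombination (replicate n 0#) gs ≈ 0#
  linearCombination-0 []       = refl
  linearCombination-0 (g ∷ gs) = trans (+-cong (zeroˡ g) (linearCombination-0 gs)) (+-identityʳ 0#)

  linearCombination-+ : ∀ {n} (cs ds gs : Vec Carrier n) →
    linearCombination (zipWith _+_ cs ds) gs ≈ linearCombination cs gs + linearCombination ds gs
  linearCombination-+ []       []       []       = sym (+-identityʳ 0#)
  linearCombination-+ (c ∷ cs) (d ∷ ds) (g ∷ gs) =
    trans (+-congˡ (linearCombination-+ cs ds gs))
      (solve 5 (λ c d g s t → (c :+ d) :* g :+ (s :+ t) := (c :* g :+ s) :+ (d :* g :+ t)) refl c d g _ _)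

  linearCombination-* : ∀ {n} r (cs gs : Vec Carrier n) →
    linearCombination (Vec.map (r *_) cs) gs ≈ r * linearCombination cs gs
  linearCombination-* r []       []       = sym (zeroʳ r)
  linearCombination-* r (c ∷ cs) (g ∷ gs) =
    trans (+-congˡ (linearCombination-* r cs gs))
      (solve 4 (λ r c g s → r :* c :* g :+ r :* s := r :* (c :* g :+ s)) refl r c g _)

  generator-∈ : ∀ {n} (gs : Vec Carrier n) i → lookup gs i ∈⟨ gs ⟩
  generator-∈ (g ∷ gs) zero    = 1# ∷ replicate _ 0# ,
    sym (trans (+-cong (*-identityˡ g) (linearCombination-0 gs)) (+-identityʳ g))
  generator-∈ (g ∷ gs) (suc i) with generator-∈ gs i
  ... | cs , e = 0# ∷ cs , trans e (sym (trans (+-congʳ (zeroˡ g)) (+-identityˡ _)))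

  module _ {n} {gs : Vec Carrier n} where

    ∈-resp-≈ : ∀ {a b} → a ≈ b → a ∈⟨ gs ⟩ → b ∈⟨ gs ⟩
    ∈-resp-≈ a≈b (cs , e) = cs , trans (sym a≈b) e

    0∈ : 0# ∈⟨ gs ⟩
    0∈ = replicate n 0# , sym (linearCombination-0 gs)

    +-∈ : ∀ {a b} → a ∈⟨ gs ⟩ → b ∈⟨ gs ⟩ → a + b ∈⟨ gs ⟩
    +-∈ (cs , e) (ds , f) = zipWith _+_ cs ds , trans (+-cong e f) (sym (linearCombination-+ cs ds gs))

    *-∈ : ∀ r {a} → a ∈⟨ gs ⟩ → r * a ∈⟨ gs ⟩
    *-∈ r (cs , e) = Vec.map (r *_) cs , trans (*-congˡ e) (sym (linearCombination-* r cs gs))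

    -‿∈ : ∀ {a} → a ∈⟨ gs ⟩ → - a ∈⟨ gs ⟩
    -‿∈ {a} a∈ = ∈-resp-≈ (-1*x≈-x a) (*-∈ (- 1#) a∈)

  module Quotient {n} (gs : Vec Carrier n) where

    -- Congruence modulo the ideal, phrased without subtraction so that the
    -- congruence laws are semiring identities.
    infix 4 _≈ᴵ_
    _≈ᴵ_ : Carrier → Carrier → Set (c ⊔ ℓ)
    a ≈ᴵ b = Σ Carrier λ t → t ∈⟨ gs ⟩ × a ≈ b + t

    ≈⇒≈ᴵ : ∀ {a b} → a ≈ b → a ≈ᴵ b
    ≈⇒≈ᴵ {a} {b} a≈b = 0# , 0∈ , trans a≈b (sym (+-identityʳ b))

    ∈⇒≈ᴵ0 : ∀ {t} → t ∈⟨ gs ⟩ → t ≈ᴵ 0#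
    ∈⇒≈ᴵ0 {t} t∈ = t , t∈ , sym (+-identityˡ t)

    ≈ᴵ0⇒∈ : ∀ {t} → t ≈ᴵ 0# → t ∈⟨ gs ⟩
    ≈ᴵ0⇒∈ (s , s∈ , e) = ∈-resp-≈ (sym (trans e (+-identityˡ s))) s∈

    ≈ᴵ-sym : ∀ {a b} → a ≈ᴵ b → b ≈ᴵ a
    ≈ᴵ-sym {a} {b} (t , t∈ , a≈b+t) = - t , -‿∈ t∈ , (begin
      b                ≈⟨ +-identityʳ b ⟨
      b + 0#           ≈⟨ +-congˡ (-‿inverseʳ t) ⟨
      b + (t + - t)    ≈⟨ +-assoc b t (- t) ⟨
      b + t + - t      ≈⟨ +-congʳ a≈b+t ⟨
      a + - t          ∎)
      where open ≈-Reasoning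

    ≈ᴵ-trans : ∀ {a b d} → a ≈ᴵ b → b ≈ᴵ d → a ≈ᴵ d
    ≈ᴵ-trans (t , t∈ , a≈b+t) (s , s∈ , b≈d+s) =
      s + t , +-∈ s∈ t∈ , trans a≈b+t (trans (+-congʳ b≈d+s) (+-assoc _ s t))

    +-congᴵ : ∀ {a a′ b b′} → a ≈ᴵ b → a′ ≈ᴵ b′ → a + a′ ≈ᴵ b + b′
    +-congᴵ (t , t∈ , e) (t′ , t′∈ , e′) = t + t′ , +-∈ t∈ t′∈ ,
      trans (+-cong e e′)
        (solve 4 (λ b b′ t t′ → (b :+ t) :+ (b′ :+ t′) := (b :+ b′) :+ (t :+ t′)) refl _ _ t t′)

    *-congᴵ : ∀ {a a′ b b′} → a ≈ᴵ b → a′ ≈ᴵ b′ → a * a′ ≈ᴵ b * b′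
    *-congᴵ {b = b} {b′} (t , t∈ , e) (t′ , t′∈ , e′) =
      b′ * t + (b + t) * t′ , +-∈ (*-∈ b′ t∈) (*-∈ (b + t) t′∈) ,
      trans (*-cong e e′)
        (solve 4 (λ b b′ t t′ → (b :+ t) :* (b′ :+ t′) := b :* b′ :+ (b′ :* t :+ (b :+ t) :* t′)) refl b b′ t t′)

    -‿congᴵ : ∀ {a b} → a ≈ᴵ b → - a ≈ᴵ - b
    -‿congᴵ (t , t∈ , e) = - t , -‿∈ t∈ , trans (-‿cong e) (sym (-‿+-comm _ t))

    quotientRing : CommutativeRing c (c ⊔ ℓ)
    quotientRing = record
      { _≈_ = _≈ᴵ_
      ; isCommutativeRing = record
        { isRing = record
          { +-isAbelianGroup = record
            { isGroup = record
              { isMonoid = record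
                { isSemigroup = record
                  { isMagma = record
                    { isEquivalence = record { refl = ≈⇒≈ᴵ refl ; sym = ≈ᴵ-sym ; trans = ≈ᴵ-trans }
                    ; ∙-cong = +-congᴵ }
                  ; assoc = λ a b d → ≈⇒≈ᴵ (+-assoc a b d) }
                ; identity = (λ a → ≈⇒≈ᴵ (+-identityˡ a)) , (λ a → ≈⇒≈ᴵ (+-identityʳ a)) }
              ; inverse = (λ a → ≈⇒≈ᴵ (-‿inverseˡ a)) , (λ a → ≈⇒≈ᴵ (-‿inverseʳ a))
              ; ⁻¹-cong = -‿congᴵ }
            ; comm = λ a b → ≈⇒≈ᴵ (+-comm a b) }
          ; *-cong = *-congᴵ
          ; *-assoc = λ a b d → ≈⇒≈ᴵ (*-assoc a b d)
          ; *-identity = (λ a → ≈⇒≈ᴵ (*-identityˡ a)) , (λ a → ≈⇒≈ᴵ (*-identityʳ a))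
          ; distrib = (λ a b d → ≈⇒≈ᴵ (distribˡ a b d)) , (λ a b d → ≈⇒≈ᴵ (distribʳ a b d)) }
        ; *-comm = λ a b → ≈⇒≈ᴵ (*-comm a b) } }

module TileRelations {c ℓ} (R : CommutativeRing c ℓ) where

  open CommutativeRing R
  open import Algebra.Definitions.RawSemiring (Semiring.rawSemiring semiring) using (_^_)
  open import Algebra.Properties.Semiring.Mult semiring using (_×_; ×-congʳ; ×-homo-+; ×-assocˡ; ×-assoc-*)
  open import Algebra.Properties.Ring ring using (+-cancelˡ; +-cancelʳ)
  open import Algebra.Solver.Ring.NaturalCoefficients.Default commutativeSemiring
  private module ≈-Reasoning = Relation.Binary.Reasoning.Setoid setoid

  powerSum : Carrier → ℕ → Carrier
  powerSum z zero    = 1#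
  powerSum z (suc n) = powerSum z n + z ^ suc n

  module _ {z w : Carrier} ([z+1]w≈0 : (z + 1#) * w ≈ 0#) where

    z^[2m+1]w+w≈0 : ∀ m → z ^ suc (2 ℕ.* m) * w + w ≈ 0#
    z^[2m+1]w+w≈0 zero    = trans (solve 2 (λ z w → z :* con 1 :* w :+ w := (z :+ con 1) :* w) refl z w) [z+1]w≈0
    -- z^(2m+3) w + w = z² (z^(2m+1) w + w) + (1 − z)(z + 1) w, with the last term moved left.
    z^[2m+1]w+w≈0 (suc m) = subst (λ n → z ^ suc n * w + w ≈ 0#) (≡.sym (ℕₚ.*-suc 2 m)) (begin
      z * (z * P) * w + w                           ≈⟨ +-identityʳ _ ⟨
      z * (z * P) * w + w + 0#                      ≈⟨ +-congˡ (zeroʳ z) ⟨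
      z * (z * P) * w + w + z * 0#                  ≈⟨ +-congˡ (*-congˡ [z+1]w≈0) ⟨
      z * (z * P) * w + w + z * ((z + 1#) * w)      ≈⟨ solve 3 (λ z P w → z :* (z :* P) :* w :+ w :+ z :* ((z :+ con 1) :* w)
                                                                   := z :* z :* (P :* w :+ w) :+ (z :+ con 1) :* w) refl z P w ⟩
      z * z * (P * w + w) + (z + 1#) * w            ≈⟨ +-cong (*-congˡ (z^[2m+1]w+w≈0 m)) [z+1]w≈0 ⟩
      z * z * 0# + 0#                               ≈⟨ trans (+-identityʳ _) (zeroʳ _) ⟩
      0#                                            ∎)
      where
      P = z ^ suc (2 ℕ.* m)
      open ≈-Reasoning

    powerSum[2m]w≈w : ∀ m → powerSum z (2 ℕ.* m) * w ≈ w
    powerSum[2m]w≈w zero    = *-identityˡ w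
    powerSum[2m]w≈w (suc m) = subst (λ n → powerSum z n * w ≈ w) (≡.sym (ℕₚ.*-suc 2 m)) (begin
      (S + P + z * P) * w
        ≈⟨ solve 4 (λ S P z w → (S :+ P :+ z :* P) :* w := S :* w :+ P :* ((z :+ con 1) :* w)) refl S P z w ⟩
      S * w + P * ((z + 1#) * w)   ≈⟨ +-cong (powerSum[2m]w≈w m) (*-congˡ [z+1]w≈0) ⟩
      w + P * 0#                   ≈⟨ trans (+-congˡ (zeroʳ P)) (+-identityʳ w) ⟩
      w                            ∎)
      where
      S = powerSum z (2 ℕ.* m)
      P = z ^ suc (2 ℕ.* m)
      open ≈-Reasoning

  powerSum[2m]+m×[y+1]≈1 : ∀ {y} → (y + 1#) * (y + 1#) ≈ 0# → ∀ m → powerSum y (2 ℕ.* m) + m × (y + 1#) ≈ 1#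
  powerSum[2m]+m×[y+1]≈1 u²≈0 zero    = +-identityʳ 1#
  powerSum[2m]+m×[y+1]≈1 {y} u²≈0 (suc m) =
    subst (λ n → powerSum y n + suc m × (y + 1#) ≈ 1#) (≡.sym (ℕₚ.*-suc 2 m)) (begin
    S + P + y * P + ((y + 1#) + M)        ≈⟨ solve 4 (λ S P y M → S :+ P :+ y :* P :+ ((y :+ con 1) :+ M)
                                                         := S :+ M :+ (P :* (y :+ con 1) :+ (y :+ con 1))) refl S P y M ⟩
    S + M + (P * (y + 1#) + (y + 1#))     ≈⟨ +-cong (powerSum[2m]+m×[y+1]≈1 u²≈0 m) (z^[2m+1]w+w≈0 u²≈0 m) ⟩
    1# + 0#                               ≈⟨ +-identityʳ 1# ⟩
    1#                                    ∎)
    where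
    S = powerSum y (2 ℕ.* m)
    P = y ^ suc (2 ℕ.* m)
    M = m × (y + 1#)
    open ≈-Reasoning

  module OneSided (x y : Carrier) (m : ℕ)
    (H₁≈0 : powerSum y (2 ℕ.* m) + x ≈ 0#)
    (H₃≈0 : y + powerSum x (2 ℕ.* m) ≈ 0#)
    ([x+1][y+1]≈0 : (x + 1#) * (y + 1#) ≈ 0#) where

    [y+1]²≈0 : (y + 1#) * (y + 1#) ≈ 0#
    [y+1]²≈0 = begin
      (y + 1#) * (y + 1#)                        ≈⟨ distribʳ (y + 1#) y 1# ⟩
      y * (y + 1#) + 1# * (y + 1#)               ≈⟨ +-congˡ (*-identityˡ (y + 1#)) ⟩
      y * (y + 1#) + (y + 1#)                    ≈⟨ +-congˡ (powerSum[2m]w≈w [x+1][y+1]≈0 m) ⟨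
      y * (y + 1#) + S * (y + 1#)                ≈⟨ distribʳ (y + 1#) y S ⟨
      (y + S) * (y + 1#)                         ≈⟨ *-congʳ H₃≈0 ⟩
      0# * (y + 1#)                              ≈⟨ zeroˡ (y + 1#) ⟩
      0#                                         ∎
      where
      S = powerSum x (2 ℕ.* m)
      open ≈-Reasoning

    x+1≈m×[y+1] : x + 1# ≈ m × (y + 1#)
    x+1≈m×[y+1] = begin
      x + 1#                            ≈⟨ +-congˡ (powerSum[2m]+m×[y+1]≈1 [y+1]²≈0 m) ⟨
      x + (S + m × (y + 1#))            ≈⟨ solve 3 (λ x S M → x :+ (S :+ M) := S :+ x :+ M) refl x S (m × (y + 1#)) ⟩
      S + x + m × (y + 1#)              ≈⟨ +-congʳ H₁≈0 ⟩
      0# + m × (y + 1#)                 ≈⟨ +-identityˡ _ ⟩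
      m × (y + 1#)                      ∎
      where
      S = powerSum y (2 ℕ.* m)
      open ≈-Reasoning

  module Relations (x y : Carrier) (m : ℕ)
    (H₁≈0 : powerSum y (2 ℕ.* m) + x ≈ 0#)
    (H₃≈0 : y + powerSum x (2 ℕ.* m) ≈ 0#)
    (H₅≈0 : x * y + x + y + 1# ≈ 0#) where

    private
      [x+1][y+1]≈0 : (x + 1#) * (y + 1#) ≈ 0#
      [x+1][y+1]≈0 =
        trans (solve 2 (λ x y → (x :+ con 1) :* (y :+ con 1) := x :* y :+ x :+ y :+ con 1) refl x y) H₅≈0

      module XY = OneSided x y m H₁≈0 H₃≈0 [x+1][y+1]≈0
      module YX = OneSided y x m (trans (+-comm _ _) H₃≈0) (trans (+-comm _ _) H₁≈0)
                   (trans (*-comm _ _) [x+1][y+1]≈0)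

      ×1-* : ∀ n a → (n × 1#) * a ≈ n × a
      ×1-* n a = trans (×-assoc-* n 1# a) (×-congʳ n (*-identityˡ a))

    m²×[y+1]≈y+1 : (m ℕ.* m) × (y + 1#) ≈ y + 1#
    m²×[y+1]≈y+1 = begin
      (m ℕ.* m) × (y + 1#)     ≈⟨ ×-assocˡ (y + 1#) m m ⟨
      m × (m × (y + 1#))       ≈⟨ ×-congʳ m XY.x+1≈m×[y+1] ⟨
      m × (x + 1#)             ≈⟨ YX.x+1≈m×[y+1] ⟨
      y + 1#                   ∎
      where open ≈-Reasoning

    D₁-relation : y ^ 2 + (1# + 1#) * y + 1# ≈ 0#
    D₁-relation = trans
      (solve 1 (λ y → y :^ 2 :+ (con 1 :+ con 1) :* y :+ con 1 := (y :+ con 1) :* (y :+ con 1)) refl y)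
      XY.[y+1]²≈0

    D₂-relation : ∀ a → suc a ℕ.+ m ≡ m ℕ.* m → (a × 1#) * y + x + suc a × 1# ≈ 0#
    D₂-relation a eq = +-cancelʳ (y + 1#) _ 0# (begin
      (a × 1#) * y + x + suc a × 1# + (y + 1#)        ≈⟨ solve 3 (λ A x y → A :* y :+ x :+ (con 1 :+ A) :+ (y :+ con 1)
                                                                      := (con 1 :+ A) :* (y :+ con 1) :+ (x :+ con 1)) refl (a × 1#) x y ⟩
      suc a × 1# * (y + 1#) + (x + 1#)                ≈⟨ +-cong (×1-* (suc a) (y + 1#)) XY.x+1≈m×[y+1] ⟩
      suc a × (y + 1#) + m × (y + 1#)                 ≈⟨ ×-homo-+ (y + 1#) (suc a) m ⟨
      (suc a ℕ.+ m) × (y + 1#)                        ≡⟨ cong (_× (y + 1#)) eq ⟩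
      (m ℕ.* m) × (y + 1#)                            ≈⟨ m²×[y+1]≈y+1 ⟩
      y + 1#                                          ≈⟨ +-identityˡ (y + 1#) ⟨
      0# + (y + 1#)                                   ∎)
      where open ≈-Reasoning

    D₃-relation : ∀ a → suc a ≡ m ℕ.* m → (a × 1#) * (y + 1#) ≈ 0#
    D₃-relation a eq = trans (×1-* a (y + 1#)) (+-cancelˡ (y + 1#) _ 0# (begin
      y + 1# + a × (y + 1#)         ≡⟨ cong (_× (y + 1#)) eq ⟩
      (m ℕ.* m) × (y + 1#)          ≈⟨ m²×[y+1]≈y+1 ⟩
      y + 1#                        ≈⟨ +-identityʳ (y + 1#) ⟨
      y + 1# + 0#                   ∎))
      where open ≈-Reasoning

module ℤ[y] = Polynomials ℤ.+-*-commutativeRing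
module ℤ[x,y] = Polynomials ℤ[y].polynomialRing
open Ideal ℤ[x,y].polynomialRing

coeff₁≡coefficient : ∀ a j → coeff₁ a j ≡ ℤ[y].coefficient a j
coeff₁≡coefficient []      j       = ≡.refl
coeff₁≡coefficient (c ∷ a) zero    = ≡.refl
coeff₁≡coefficient (c ∷ a) (suc j) = coeff₁≡coefficient a j

coeff≡coefficient : ∀ p i j → coeff p i j ≡ ℤ[y].coefficient (ℤ[x,y].coefficient p i) j
coeff≡coefficient []      i       j = ≡.refl
coeff≡coefficient (a ∷ p) zero    j = coeff₁≡coefficient a j
coeff≡coefficient (a ∷ p) (suc i) j = coeff≡coefficient p i j

≋⇒≈P : ∀ {p q} → p ℤ[x,y].≋ q → p ≈P q
≋⇒≈P {p} {q} p≋q i j = begin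
  coeff p i j                                            ≡⟨ coeff≡coefficient p i j ⟩
  ℤ[y].coefficient (ℤ[x,y].coefficient p i) j            ≡⟨ ℤ[y].coefficient-≈ (ℤ[x,y].coefficient-≈ p≋q i) j ⟩
  ℤ[y].coefficient (ℤ[x,y].coefficient q i) j            ≡⟨ coeff≡coefficient q i j ⟨
  coeff q i j                                            ∎
  where open ≡-Reasoning

linearCombination≡linComb : ∀ {n} (cs gs : Vec Poly n) → linearCombination cs gs ≡ linComb cs gs
linearCombination≡linComb []       []       = ≡.refl
linearCombination≡linComb (c ∷ cs) (g ∷ gs) = cong (c *P g +P_) (linearCombination≡linComb cs gs)

∈⟨⟩⇒∈Ideal : ∀ {n t} {gs : Vec Poly n} → t ∈⟨ gs ⟩ → t ∈Ideal gs
∈⟨⟩⇒∈Ideal {t = t} {gs} (cs , t≋) =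
  cs , subst (t ≈P_) (linearCombination≡linComb cs gs) (≋⇒≈P t≋)

module ModuloTiles (m : ℕ) where

  open Quotient (tiles (suc m))
  open CommutativeRing quotientRing
    using (_≈_; _+_; _*_; 0#; 1#; trans; +-cong; +-congˡ; +-congʳ; *-congʳ; semiring)
  open import Algebra.Definitions.RawSemiring (Semiring.rawSemiring semiring) using (_^_; _×_)
  open TileRelations quotientRing

  cst≈×1 : ∀ n → cst (+ n) ≈ n × 1#
  cst≈×1 zero    = ≈⇒≈ᴵ (ℤ[x,y].≋-trans (ℤ[x,y].∷-cong ℤ[y].0∷[]≋[] ℤ[x,y].≋-refl) ℤ[x,y].0∷[]≋[])
  cst≈×1 (suc n) = +-congˡ (cst≈×1 n)

  ^P≡^ : ∀ p n → p ^P n ≡ p ^ n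
  ^P≡^ p zero    = ≡.refl
  ^P≡^ p (suc n) = cong (p *P_) (^P≡^ p n)

  sumTo≡powerSum : ∀ p n → sumTo n (p ^P_) ≡ powerSum p n
  sumTo≡powerSum p zero    = ≡.refl
  sumTo≡powerSum p (suc n) = cong₂ _+P_ (sumTo≡powerSum p n) (^P≡^ p (suc n))

  sumTo-tile : ∀ p → sumTo (2 ℕ.* suc m ∸ 2) (p ^P_) ≡ powerSum p (2 ℕ.* m)
  sumTo-tile p = ≡.trans (cong (λ n → sumTo n (p ^P_)) (cong (_∸ 2) (ℕₚ.*-suc 2 m)))
                         (sumTo≡powerSum p (2 ℕ.* m))

  tile≈0 : ∀ i → lookup (tiles (suc m)) i ≈ 0#
  tile≈0 i = ∈⇒≈ᴵ0 (generator-∈ (tiles (suc m)) i)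

  H₁≈0 : powerSum Y (2 ℕ.* m) + X ≈ 0#
  H₁≈0 = subst (_≈ 0#) (cong (_+P X) (sumTo-tile Y)) (tile≈0 zero)

  H₃≈0 : Y + powerSum X (2 ℕ.* m) ≈ 0#
  H₃≈0 = subst (_≈ 0#) (cong (Y +P_) (sumTo-tile X)) (tile≈0 (suc (suc zero)))

  H₅≈0 : X * Y + X + Y + 1# ≈ 0#
  H₅≈0 = tile≈0 (suc (suc (suc (suc zero))))

  open Relations X Y m H₁≈0 H₃≈0 H₅≈0

  ≈0⇒∈Ideal : ∀ {t} → t ≈ 0# → t ∈Ideal tiles (suc m)
  ≈0⇒∈Ideal t≈0 = ∈⟨⟩⇒∈Ideal (≈ᴵ0⇒∈ t≈0)

  D₁∈ : D₁ (suc m) ∈Ideal tiles (suc m)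
  D₁∈ = ≈0⇒∈Ideal D₁-relation

  D₂∈ : ∀ a → suc a ℕ.+ m ≡ m ℕ.* m → (cst (+ a) *P Y +P X +P cst (+ suc a)) ∈Ideal tiles (suc m)
  D₂∈ a eq = ≈0⇒∈Ideal
    (trans (+-cong (+-congʳ (*-congʳ (cst≈×1 a))) (cst≈×1 (suc a))) (D₂-relation a eq))

  D₃∈ : ∀ a → suc a ≡ m ℕ.* m → (cst (+ a) *P (Y +P 1P)) ∈Ideal tiles (suc m)
  D₃∈ a eq = ≈0⇒∈Ideal (trans (*-congʳ (cst≈×1 a)) (D₃-relation a eq))

[n+2]n+1≡[n+1]² : ∀ n → suc (suc (suc n) ℕ.* n) ≡ suc n ℕ.* suc n
[n+2]n+1≡[n+1]² = solve-∀

-- Imported only here: above, _×_ is the ring's multiple n × a.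
open import Data.Product using (_×_)

proposition11 : (k : ℕ) → 3 ≤ k →
    (D₁ k ∈Ideal tiles k) × (D₂ k ∈Ideal tiles k) × (D₃ k ∈Ideal tiles k)
proposition11 (suc (suc (suc j))) (s≤s (s≤s (s≤s z≤n))) =
  D₁∈ ,
  D₂∈ (suc j ℕ.* m ∸ 1) (ℕₚ.+-comm (suc j ℕ.* m) m) ,
  D₃∈ (suc m ℕ.* suc j) ([n+2]n+1≡[n+1]² (suc j))
  where
  -- For k = 3 + j the integer coefficients (k − 2)(k − 1) − 1 of D₂ and k(k − 2)
  -- of D₃ compute to the natural numbers passed to D₂∈ and D₃∈.
  m : ℕ
  m = 2 ℕ.+ j
  open ModuloTiles m
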